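{- Let $G$ be a finite simple graph that is not edgeless (i.e. $G\neq \overline{K_n}$), with maximum degree $\Delta(G)$ and minimum degree $\delta(G)$, and let $T_1$ be an independent set of $G$. Then there exists an independent dominating set $T_2$ for $T_1$ such that $$|T_1\cap T_2| \le \frac{2\Delta(G)-\delta(G)}{2\Delta(G)}\,|T_1|.$$
   Context: All graphs are finite, undirected and simple. For $S\subseteq V(G)$, a set $T\subseteq V(G)$ is an independent dominating set for $S$ if $T$ is an independent set of $G$ and every vertex of $S$ either belongs to $T$ or has a neighbour in $T$. $\Delta(G)$ and $\delta(G)$ denote the maximum and minimum degree of $G$. -}

module Defs where

open import Data.Nat using (ℕ; zero; suc; _⊔_; _⊓_)
open import Data.Bool using (Bool; true; false)
open import Data.Fin using (Fin)
open import Data.Fin.Subset using (Subset; _∈_; _∉_; _∩_; ∣_∣)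
open import Data.List using (List; []; _∷_; foldr; map; filter; length; allFin)
open import Data.Product using (∃; ∃-syntax; _×_; _,_)
open import Data.Sum using (_⊎_)
open import Relation.Binary.PropositionalEquality using (_≡_)
open import Relation.Nullary using (¬_)
open import Relation.Nullary.Decidable using (Dec)
open import Data.Bool using (T)
open import Data.Bool.Properties using (T?)

record Graph (n : ℕ) : Set where
  field
    adj   : Fin n → Fin n → Bool
    irrefl : ∀ i → adj i i ≡ false
    sym    : ∀ i j → adj i j ≡ adj j i

open Graph public

Adj : ∀ {n} → Graph n → Fin n → Fin n → Set
Adj G u v = T (adj G u v)

degree : ∀ {n} → Graph n → Fin n → ℕ
degree {n} G v = length (filter (λ u → T? (adj G v u)) (allFin n))

maxDegree : ∀ {n} → Graph n → ℕ
maxDegree {n} G = foldr _⊔_ 0 (map (degree G) (allFin n))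

minDegree : ∀ {n} → Graph n → ℕ
minDegree {zero}  G = 0
minDegree {suc n} G = foldr _⊓_ (degree G Fin.zero) (map (degree G) (allFin (suc n)))
  where import Data.Fin as Fin

Edgeless : ∀ {n} → Graph n → Set
Edgeless G = ∀ u v → ¬ Adj G u v

Independent : ∀ {n} → Graph n → Subset n → Set
Independent G S = ∀ u v → u ∈ S → v ∈ S → ¬ Adj G u v

Dominates : ∀ {n} → Graph n → Subset n → Subset n → Set
Dominates G T S = ∀ v → v ∈ S → v ∈ T ⊎ ∃[ u ] (u ∈ T × Adj G v u)

IndepDominatingFor : ∀ {n} → Graph n → Subset n → Subset n → Set
IndepDominatingFor G T S = Independent G T × Dominates G T S

module Submission where

-- Let R = T₁, W = V ∖ R, and e(R, W) the number of R–W edges.  A greedy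
-- procedure builds an independent S ⊆ W: pick u ∈ W with the most, say a,
-- neighbours in R, put u into S, delete N(u) from R and N[u] from W, and
-- repeat.  The step covers the a vertices of R ∩ N(u) and destroys at most
-- aΔ + Δa edges (those at R ∩ N(u), and those at W ∩ N(u), whose vertices
-- have ≤ a neighbours in R by the choice of u).  So the covered set C ⊆ R,
-- all dominated by S, has e(R, W) ≤ 2Δ|C|, while δ|R| ≤ e(R, W) since R is
-- independent.  T₂ = S ∪ (R ∖ N(S)) is an independent dominating set for R
-- with |R ∩ T₂| + |C| ≤ |R|; the three inequalities give the bound.

open import Defs renaming (sym to adj-sym)
open import Data.Nat using (ℕ; zero; suc; _+_; _*_; _∸_; _≤_; _<_; _⊔_; _⊓_; z≤n; s≤s)
open import Data.Nat.Properties hiding (_≟_)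
open import Data.Bool using (Bool; true; false; _∧_; _∨_; not; T)
open import Data.Bool.Properties using (T?; T-≡; T-∧; T-∨; ∧-comm; ∧-assoc)
open import Data.Unit using (tt)
open import Data.Empty using (⊥-elim)
open import Data.Fin using (Fin; zero; suc; _≟_)
open import Data.Fin.Properties using (any?)
open import Data.Fin.Subset using (Subset; _∈_; _∩_; ∣_∣)
open import Data.List using (foldr; filter; length; tabulate)
open import Data.List.Relation.Unary.Any using (here; there)
open import Data.List.Membership.Propositional using () renaming (_∈_ to _∈ₗ_)
open import Data.List.Membership.Propositional.Properties using (∈-allFin; ∈-map⁺)
open import Data.Product using (∃-syntax; _×_; _,_; proj₁; proj₂)
open import Data.Sum using (_⊎_; inj₁; inj₂)
import Data.Vec as Vec
open import Data.Vec.Properties using (lookup∘tabulate; lookup-zipWith; []=⇒lookup; lookup⇒[]=)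
open import Function using (_∘_; id; Equivalence)
open import Relation.Nullary using (¬_; yes; no)
open import Relation.Nullary.Decidable using (⌊_⌋; toWitness; fromWitness)
open import Relation.Binary.PropositionalEquality
open import Data.Nat.Tactic.RingSolver using (solve-∀)
open import Algebra.Properties.Semiring.Sum +-*-semiring
  using (sum; sum-syntax; sum-cong-≗; sum-replicate-zero; ∑-distrib-+; ∑-comm; *-distribʳ-sum)

∧-intro : ∀ {a b} → T a → T b → T (a ∧ b)
∧-intro p q = Equivalence.from T-∧ (p , q)

∧-elim : ∀ {a b} → T (a ∧ b) → T a × T b
∧-elim = Equivalence.to T-∧

∨-inj₁ : ∀ {a} b → T a → T (a ∨ b)
∨-inj₁ b p = Equivalence.from T-∨ (inj₁ p)

∨-inj₂ : ∀ a {b} → T b → T (a ∨ b)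
∨-inj₂ a p = Equivalence.from T-∨ (inj₂ p)

∨-elim : ∀ {a b} → T (a ∨ b) → T a ⊎ T b
∨-elim = Equivalence.to T-∨

not-intro : ∀ {b} → ¬ T b → T (not b)
not-intro {false} _  = tt
not-intro {true}  ¬b = ¬b tt

not-elim : ∀ {b} → T (not b) → ¬ T b
not-elim {false} _ ()

ι : Bool → ℕ
ι true  = 1
ι false = 0

ι-mono : ∀ {a b} → (T a → T b) → ι a ≤ ι b
ι-mono {false}         _   = z≤n
ι-mono {true} {true}   _   = ≤-refl
ι-mono {true} {false} a⇒b = ⊥-elim (a⇒b tt)

ι-∨ : ∀ a b → ι (a ∨ b) ≤ ι a + ι b
ι-∨ false b = ≤-refl
ι-∨ true  b = s≤s z≤n

ι-∨-exclusive : ∀ a b → (T a → ¬ T b) → ι (a ∨ b) ≡ ι a + ι b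
ι-∨-exclusive false b     _    = refl
ι-∨-exclusive true  false _    = refl
ι-∨-exclusive true  true  excl = ⊥-elim (excl tt tt)

ι*-mono : ∀ b {k m} → (T b → k ≤ m) → ι b * k ≤ ι b * m
ι*-mono false _   = z≤n
ι*-mono true  k≤m = +-monoˡ-≤ 0 (k≤m tt)

∑-mono : ∀ {n} {f g : Fin n → ℕ} → (∀ i → f i ≤ g i) → sum f ≤ sum g
∑-mono {zero}  _   = z≤n
∑-mono {suc n} f≤g = +-mono-≤ (f≤g zero) (∑-mono (f≤g ∘ suc))

-- A vertex set is represented by its characteristic function Fin n → Bool.

_⊆ᵇ_ : ∀ {n} → (Fin n → Bool) → (Fin n → Bool) → Set
X ⊆ᵇ Y = ∀ v → T (X v) → T (Y v)

Disjoint : ∀ {n} → (Fin n → Bool) → (Fin n → Bool) → Set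
Disjoint X Y = ∀ v → T (X v) → ¬ T (Y v)

count : ∀ {n} → (Fin n → Bool) → ℕ
count {n} X = ∑[ v < n ] ι (X v)

count-mono : ∀ {n} {X Y : Fin n → Bool} → X ⊆ᵇ Y → count X ≤ count Y
count-mono X⊆Y = ∑-mono (λ v → ι-mono (X⊆Y v))

count-∪ : ∀ {n} (X Y : Fin n → Bool) → count (λ v → X v ∨ Y v) ≤ count X + count Y
count-∪ X Y = ≤-trans (∑-mono (λ v → ι-∨ (X v) (Y v))) (≤-reflexive (∑-distrib-+ (ι ∘ X) (ι ∘ Y)))

count-∪-disjoint : ∀ {n} {X Y : Fin n → Bool} → Disjoint X Y →
                   count (λ v → X v ∨ Y v) ≡ count X + count Y
count-∪-disjoint {X = X} {Y} disj =
  trans (sum-cong-≗ (λ v → ι-∨-exclusive (X v) (Y v) (disj v))) (∑-distrib-+ (ι ∘ X) (ι ∘ Y))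

count-∅ : ∀ {n} → count {n} (λ _ → false) ≡ 0
count-∅ {n} = sum-replicate-zero n

count-∧ : ∀ {n} b (X : Fin n → Bool) → count (λ v → b ∧ X v) ≡ ι b * count X
count-∧ {n} false X = count-∅ {n}
count-∧ true  X = sym (+-identityʳ (count X))

count-singleton : ∀ {n} (u : Fin n) → count (λ v → ⌊ v ≟ u ⌋) ≡ 1
count-singleton {suc n} zero    = cong suc (count-∅ {n})
count-singleton {suc n} (suc u) =
  trans (sum-cong-≗ (λ v → cong ι (⌊suc≟suc⌋ v))) (count-singleton u)
  where
  ⌊suc≟suc⌋ : ∀ v → ⌊ suc v ≟ suc u ⌋ ≡ ⌊ v ≟ u ⌋
  ⌊suc≟suc⌋ v with v ≟ u
  ... | yes _ = refl
  ... | no  _ = refl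

length-filter-tabulate : ∀ {m n} (p : Fin m → Bool) (f : Fin n → Fin m) →
                         length (filter (T? ∘ p) (tabulate f)) ≡ count (p ∘ f)
length-filter-tabulate {n = zero}  p f = refl
length-filter-tabulate {n = suc n} p f with p (f zero)
... | true  = cong suc (length-filter-tabulate p (f ∘ suc))
... | false = length-filter-tabulate p (f ∘ suc)

≤-foldr-⊔ : ∀ {x xs} → x ∈ₗ xs → x ≤ foldr _⊔_ 0 xs
≤-foldr-⊔ (here refl) = m≤m⊔n _ _
≤-foldr-⊔ (there x∈)  = ≤-trans (≤-foldr-⊔ x∈) (m≤n⊔m _ _)

foldr-⊓-≤ : ∀ {x} d {xs} → x ∈ₗ xs → foldr _⊓_ d xs ≤ x
foldr-⊓-≤ d (here refl) = m⊓n≤m _ _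
foldr-⊓-≤ d (there x∈)  = ≤-trans (m⊓n≤n _ _) (foldr-⊓-≤ d x∈)

empty-or-max : ∀ {n} (W : Fin n → Bool) (f : Fin n → ℕ) →
               (∀ x → ¬ T (W x)) ⊎ ∃[ u ] (T (W u) × (∀ x → T (W x) → f x ≤ f u))
empty-or-max {zero}  W f = inj₁ (λ ())
empty-or-max {suc n} W f with empty-or-max (W ∘ suc) (f ∘ suc) | T? (W zero)
... | inj₁ none | no  ¬w₀ = inj₁ λ { zero → ¬w₀ ; (suc x) → none x }
... | inj₁ none | yes w₀  = inj₂ (zero , w₀ , λ { zero _ → ≤-refl ; (suc x) w → ⊥-elim (none x w) })
... | inj₂ (u , w , max) | no ¬w₀ = inj₂ (suc u , w , λ { zero w₀ → ⊥-elim (¬w₀ w₀) ; (suc x) → max x })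
... | inj₂ (u , w , max) | yes w₀ with f zero ≤? f (suc u)
...   | yes f₀≤fu = inj₂ (suc u , w , λ { zero _ → f₀≤fu ; (suc x) → max x })
...   | no  f₀≰fu = inj₂ (zero , w₀ , λ { zero _ → ≤-refl
                                         ; (suc x) w′ → ≤-trans (max x w′) (<⇒≤ (≰⇒> f₀≰fu)) })

degree≡count : ∀ {n} (G : Graph n) v → degree G v ≡ count (adj G v)
degree≡count G v = length-filter-tabulate (adj G v) id

degree≤Δ : ∀ {n} (G : Graph n) v → degree G v ≤ maxDegree G
degree≤Δ G v = ≤-foldr-⊔ (∈-map⁺ (degree G) (∈-allFin v))

δ≤degree : ∀ {n} (G : Graph n) v → minDegree G ≤ degree G v
δ≤degree {suc n} G v = foldr-⊓-≤ (degree G zero) (∈-map⁺ (degree G) (∈-allFin v))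

module _ {n} (G : Graph n) where

  Adj-sym : ∀ {u v} → Adj G u v → Adj G v u
  Adj-sym {u} {v} = subst T (adj-sym G u v)

  Adj-irrefl : ∀ {v} → ¬ Adj G v v
  Adj-irrefl {v} a = subst T (irrefl G v) a

  IndependentB : (Fin n → Bool) → Set
  IndependentB X = ∀ u v → T (X u) → T (X v) → ¬ Adj G u v

  HasNbrIn : (Fin n → Bool) → Fin n → Set
  HasNbrIn S v = ∃[ s ] (T (S s) × Adj G v s)

  nbrs : (Fin n → Bool) → Fin n → ℕ
  nbrs X v = count (λ w → adj G v w ∧ X w)

  nbrs≤Δ : ∀ X v → nbrs X v ≤ maxDegree G
  nbrs≤Δ X v = begin
    nbrs X v              ≤⟨ count-mono {n} (λ w → proj₁ ∘ ∧-elim) ⟩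
    count (adj G v)       ≡⟨ degree≡count G v ⟨
    degree G v            ≤⟨ degree≤Δ G v ⟩
    maxDegree G           ∎
    where open ≤-Reasoning

  edges : (Fin n → Bool) → (Fin n → Bool) → ℕ
  edges X Y = ∑[ t < n ] count (λ x → X t ∧ adj G t x ∧ Y x)

  edges-by-rows : ∀ X Y → edges X Y ≡ ∑[ t < n ] (ι (X t) * nbrs Y t)
  edges-by-rows X Y = sum-cong-≗ (λ t → count-∧ (X t) (λ x → adj G t x ∧ Y x))

  edges-sym : ∀ X Y → edges X Y ≡ edges Y X
  edges-sym X Y = trans (∑-comm (λ t x → ι (X t ∧ adj G t x ∧ Y x)))
                        (sum-cong-≗ λ x → sum-cong-≗ λ t → cong ι (reverse t x))
    where
    reverse : ∀ t x → X t ∧ adj G t x ∧ Y x ≡ Y x ∧ adj G x t ∧ X t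
    reverse t x = begin
      X t ∧ adj G t x ∧ Y x     ≡⟨ ∧-comm (X t) _ ⟩
      (adj G t x ∧ Y x) ∧ X t   ≡⟨ cong (_∧ X t) (∧-comm (adj G t x) (Y x)) ⟩
      (Y x ∧ adj G t x) ∧ X t   ≡⟨ ∧-assoc (Y x) _ (X t) ⟩
      Y x ∧ adj G t x ∧ X t     ≡⟨ cong (λ b → Y x ∧ b ∧ X t) (adj-sym G t x) ⟩
      Y x ∧ adj G x t ∧ X t     ∎
      where open ≡-Reasoning

  edges-≤ : ∀ X Y {m} → (∀ t → T (X t) → nbrs Y t ≤ m) → edges X Y ≤ count X * m
  edges-≤ X Y {m} bound = begin
    edges X Y                           ≡⟨ edges-by-rows X Y ⟩
    ∑[ t < n ] (ι (X t) * nbrs Y t)     ≤⟨ ∑-mono (λ t → ι*-mono (X t) (bound t)) ⟩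
    ∑[ t < n ] (ι (X t) * m)            ≡⟨ *-distribʳ-sum m (ι ∘ X) ⟨
    count X * m                         ∎
    where open ≤-Reasoning

  edges-≥ : ∀ X Y {m} → (∀ t → T (X t) → m ≤ nbrs Y t) → count X * m ≤ edges X Y
  edges-≥ X Y {m} bound = begin
    count X * m                         ≡⟨ *-distribʳ-sum m (ι ∘ X) ⟩
    ∑[ t < n ] (ι (X t) * m)            ≤⟨ ∑-mono (λ t → ι*-mono (X t) (bound t)) ⟩
    ∑[ t < n ] (ι (X t) * nbrs Y t)     ≡⟨ edges-by-rows X Y ⟨
    edges X Y                           ∎
    where open ≤-Reasoning

  -- An independent set R sends all its edges to its complement, so δ|R| ≤ e(R, V ∖ R).
  independent-edges : ∀ R → IndependentB R → count R * minDegree G ≤ edges R (not ∘ R)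
  independent-edges R R-indep = edges-≥ R (not ∘ R) λ t t∈R → begin
    minDegree G              ≤⟨ δ≤degree G t ⟩
    degree G t               ≡⟨ degree≡count G t ⟩
    count (adj G t)          ≤⟨ count-mono (λ w a → ∧-intro a (not-intro (λ w∈R → R-indep t w t∈R w∈R a))) ⟩
    nbrs (not ∘ R) t         ∎
    where open ≤-Reasoning

  edges-split : ∀ X Y X₁ Y₁ X₂ Y₂ X₃ Y₃ →
    (∀ t x → T (X t) → Adj G t x → T (Y x) →
       (T (X₁ t) × T (Y₁ x)) ⊎ (T (X₂ t) × T (Y₂ x)) ⊎ (T (X₃ t) × T (Y₃ x))) →
    edges X Y ≤ edges X₁ Y₁ + edges X₂ Y₂ + edges X₃ Y₃
  edges-split X Y X₁ Y₁ X₂ Y₂ X₃ Y₃ cover = begin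
      edges X Y
    ≤⟨ ∑-mono row-split ⟩
      ∑[ t < n ] (row X₁ Y₁ t + (row X₂ Y₂ t + row X₃ Y₃ t))
    ≡⟨ ∑-distrib-+ (row X₁ Y₁) _ ⟩
      edges X₁ Y₁ + ∑[ t < n ] (row X₂ Y₂ t + row X₃ Y₃ t)
    ≡⟨ cong (edges X₁ Y₁ +_) (∑-distrib-+ (row X₂ Y₂) (row X₃ Y₃)) ⟩
      edges X₁ Y₁ + (edges X₂ Y₂ + edges X₃ Y₃)
    ≡⟨ +-assoc (edges X₁ Y₁) _ _ ⟨
      edges X₁ Y₁ + edges X₂ Y₂ + edges X₃ Y₃
    ∎
    where
    open ≤-Reasoning
    edge : (Fin n → Bool) → (Fin n → Bool) → Fin n → Fin n → Bool
    edge X′ Y′ t x = X′ t ∧ adj G t x ∧ Y′ x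
    row : (Fin n → Bool) → (Fin n → Bool) → Fin n → ℕ
    row X′ Y′ t = count (edge X′ Y′ t)
    edge-intro : ∀ X′ Y′ {t x} → T (X′ t) × T (Y′ x) → Adj G t x → T (edge X′ Y′ t x)
    edge-intro X′ Y′ (t∈ , x∈) a = ∧-intro t∈ (∧-intro a x∈)
    covered : ∀ t → edge X Y t ⊆ᵇ (λ x → edge X₁ Y₁ t x ∨ edge X₂ Y₂ t x ∨ edge X₃ Y₃ t x)
    covered t x e with ∧-elim e
    ... | t∈X , a∧x∈Y with ∧-elim a∧x∈Y
    ... | a , x∈Y with cover t x t∈X a x∈Y
    ... | inj₁ p        = ∨-inj₁ (edge X₂ Y₂ t x ∨ edge X₃ Y₃ t x) (edge-intro X₁ Y₁ p a)
    ... | inj₂ (inj₁ p) = ∨-inj₂ (edge X₁ Y₁ t x) (∨-inj₁ (edge X₃ Y₃ t x) (edge-intro X₂ Y₂ p a))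
    ... | inj₂ (inj₂ p) = ∨-inj₂ (edge X₁ Y₁ t x) (∨-inj₂ (edge X₂ Y₂ t x) (edge-intro X₃ Y₃ p a))
    row-split : ∀ t → row X Y t ≤ row X₁ Y₁ t + (row X₂ Y₂ t + row X₃ Y₃ t)
    row-split t = begin
      row X Y t                                                  ≤⟨ count-mono (covered t) ⟩
      count (λ x → edge X₁ Y₁ t x ∨ edge X₂ Y₂ t x ∨ edge X₃ Y₃ t x) ≤⟨ count-∪ (edge X₁ Y₁ t) _ ⟩
      row X₁ Y₁ t + count (λ x → edge X₂ Y₂ t x ∨ edge X₃ Y₃ t x)  ≤⟨ +-monoʳ-≤ (row X₁ Y₁ t) (count-∪ (edge X₂ Y₂ t) _) ⟩
      row X₁ Y₁ t + (row X₂ Y₂ t + row X₃ Y₃ t)                  ∎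

  _∩N_ : (Fin n → Bool) → Fin n → Fin n → Bool
  (X ∩N u) v = adj G u v ∧ X v

  _∖N_ : (Fin n → Bool) → Fin n → Fin n → Bool
  (X ∖N u) v = X v ∧ not (adj G u v)

  _∖N[_] : (Fin n → Bool) → Fin n → Fin n → Bool
  (X ∖N[ u ]) v = (X ∖N u) v ∧ not ⌊ v ≟ u ⌋

  ∩N-elim : ∀ {X u v} → T ((X ∩N u) v) → Adj G u v × T (X v)
  ∩N-elim {X} {u} {v} = ∧-elim {adj G u v}

  ∖N-elim : ∀ {X u v} → T ((X ∖N u) v) → T (X v) × ¬ Adj G u v
  ∖N-elim {X} {u} {v} p with ∧-elim {X v} p
  ... | v∈X , v∉N = v∈X , not-elim v∉N

  ∖N[]-elim : ∀ {X u v} → T ((X ∖N[ u ]) v) → T (X v) × ¬ Adj G u v × v ≢ u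
  ∖N[]-elim {X} {u} {v} p with ∧-elim {(X ∖N u) v} p
  ... | p′ , v≢u with ∖N-elim {X} p′
  ...   | v∈X , v∉N = v∈X , v∉N , not-elim v≢u ∘ fromWitness

  -- Deleting the closed neighbourhood of a member u strictly shrinks W;
  -- this makes the greedy procedure terminate.
  ∖N[]-shrinks : ∀ W u → T (W u) → count (W ∖N[ u ]) < count W
  ∖N[]-shrinks W u u∈W = begin
    suc (count W′)                      ≡⟨ +-comm 1 (count W′) ⟩
    count W′ + 1                        ≡⟨ cong (count W′ +_) (count-singleton u) ⟨
    count W′ + count (λ v → ⌊ v ≟ u ⌋)  ≡⟨ count-∪-disjoint disjoint ⟨
    count (λ v → W′ v ∨ ⌊ v ≟ u ⌋)      ≤⟨ count-mono {n} included ⟩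
    count W                             ∎
    where
    open ≤-Reasoning
    W′ : Fin n → Bool
    W′ = W ∖N[ u ]
    disjoint : Disjoint W′ (λ v → ⌊ v ≟ u ⌋)
    disjoint v v∈W′ v≡u = proj₂ (proj₂ (∖N[]-elim {W} v∈W′)) (toWitness v≡u)
    included : (λ v → W′ v ∨ ⌊ v ≟ u ⌋) ⊆ᵇ W
    included v p with ∨-elim p
    ... | inj₁ v∈W′ = proj₁ (∖N[]-elim {W} v∈W′)
    ... | inj₂ v≡u  = subst (T ∘ W) (sym (toWitness v≡u)) u∈W

  edges-around : ∀ R W u →
    edges R W ≤ edges (R ∩N u) (λ _ → true) + edges (R ∖N u) (W ∖N[ u ]) + edges R (W ∩N u)
  edges-around R W u =
    edges-split R W (R ∩N u) (λ _ → true) (R ∖N u) (W ∖N[ u ]) R (W ∩N u) cover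
    where
    cover : ∀ t x → T (R t) → Adj G t x → T (W x) →
            (T ((R ∩N u) t) × T true) ⊎ (T ((R ∖N u) t) × T ((W ∖N[ u ]) x)) ⊎ (T (R t) × T ((W ∩N u) x))
    cover t x t∈R a x∈W with T? (adj G u t) | T? (adj G u x)
    ... | yes ut | _      = inj₁ (∧-intro ut t∈R , tt)
    ... | no ¬ut | yes ux = inj₂ (inj₂ (t∈R , ∧-intro ux x∈W))
    ... | no ¬ut | no ¬ux = inj₂ (inj₁ (∧-intro t∈R (not-intro ¬ut) ,
                                      ∧-intro (∧-intro x∈W (not-intro ¬ux)) (not-intro x≢u)))
      where
      x≢u : ¬ T ⌊ x ≟ u ⌋
      x≢u x≡u = ¬ut (Adj-sym (subst (Adj G t) (toWitness x≡u) a))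

  edges-from-nbhd : ∀ R u → edges (R ∩N u) (λ _ → true) ≤ nbrs R u * maxDegree G
  edges-from-nbhd R u = edges-≤ (R ∩N u) (λ _ → true) (λ t _ → nbrs≤Δ _ t)

  edges-into-nbhd : ∀ R W u → (∀ x → T (W x) → nbrs R x ≤ nbrs R u) →
                    edges R (W ∩N u) ≤ maxDegree G * nbrs R u
  edges-into-nbhd R W u u-max = begin
    edges R (W ∩N u)          ≡⟨ edges-sym R (W ∩N u) ⟩
    edges (W ∩N u) R          ≤⟨ edges-≤ (W ∩N u) R (λ x x∈ → u-max x (proj₂ (∩N-elim {W} x∈))) ⟩
    nbrs W u * nbrs R u       ≤⟨ *-monoˡ-≤ (nbrs R u) (nbrs≤Δ W u) ⟩
    maxDegree G * nbrs R u    ∎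
    where open ≤-Reasoning

  record Greedy (R W : Fin n → Bool) : Set where
    field
      S C           : Fin n → Bool
      S-independent : IndependentB S
      S⊆W           : S ⊆ᵇ W
      C⊆R           : C ⊆ᵇ R
      C-dominated   : ∀ t → T (C t) → HasNbrIn S t
      edges-bound   : edges R W ≤ count C * (2 * maxDegree G)

  greedy-empty : ∀ R W → (∀ x → ¬ T (W x)) → Greedy R W
  greedy-empty R W W-empty = record
    { S = λ _ → false ; C = λ _ → false
    ; S-independent = λ _ _ () ; S⊆W = λ _ () ; C⊆R = λ _ () ; C-dominated = λ _ ()
    ; edges-bound = ≤-trans (edges-≤ R W no-nbrs) (≤-trans (≤-reflexive (*-zeroʳ (count R))) z≤n) }
    where
    no-nbrs : ∀ t → T (R t) → nbrs W t ≤ 0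
    no-nbrs t _ = ≤-trans (count-mono {n} {Y = λ _ → false} (λ w p → W-empty w (proj₂ (∧-elim p))))
                          (≤-reflexive (count-∅ {n}))

  module GreedyStep (R W : Fin n → Bool) (u : Fin n) (u∈W : T (W u))
                    (u-max : ∀ x → T (W x) → nbrs R x ≤ nbrs R u)
                    (rest : Greedy (R ∖N u) (W ∖N[ u ])) where
    open Greedy rest renaming (S to S′; C to C′; S-independent to S′-independent;
      S⊆W to S′⊆W′; C⊆R to C′⊆R′; C-dominated to C′-dominated; edges-bound to edges′-bound)

    Δ : ℕ
    Δ = maxDegree G

    a : ℕ
    a = nbrs R u

    S : Fin n → Bool
    S x = ⌊ x ≟ u ⌋ ∨ S′ x

    C : Fin n → Bool
    C t = (R ∩N u) t ∨ C′ t

    S′-avoids-N[u] : ∀ {x} → T (S′ x) → ¬ Adj G u x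
    S′-avoids-N[u] {x} x∈S′ = proj₁ (proj₂ (∖N[]-elim {W} (S′⊆W′ x x∈S′)))

    S-independent : IndependentB S
    S-independent x y x∈S y∈S with ∨-elim x∈S | ∨-elim y∈S
    ... | inj₁ x≡u  | inj₁ y≡u  = λ xy → Adj-irrefl (subst₂ (Adj G) (toWitness x≡u) (toWitness y≡u) xy)
    ... | inj₁ x≡u  | inj₂ y∈S′ = λ xy → S′-avoids-N[u] y∈S′ (subst (λ z → Adj G z y) (toWitness x≡u) xy)
    ... | inj₂ x∈S′ | inj₁ y≡u  = λ xy → S′-avoids-N[u] x∈S′ (Adj-sym (subst (Adj G x) (toWitness y≡u) xy))
    ... | inj₂ x∈S′ | inj₂ y∈S′ = S′-independent x y x∈S′ y∈S′

    S⊆W : S ⊆ᵇ W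
    S⊆W x x∈S with ∨-elim x∈S
    ... | inj₁ x≡u  = subst (T ∘ W) (sym (toWitness x≡u)) u∈W
    ... | inj₂ x∈S′ = proj₁ (∖N[]-elim {W} (S′⊆W′ x x∈S′))

    C⊆R : C ⊆ᵇ R
    C⊆R t t∈C with ∨-elim t∈C
    ... | inj₁ t∈N  = proj₂ (∩N-elim {R} t∈N)
    ... | inj₂ t∈C′ = proj₁ (∖N-elim {R} (C′⊆R′ t t∈C′))

    C-dominated : ∀ t → T (C t) → HasNbrIn S t
    C-dominated t t∈C with ∨-elim t∈C
    ... | inj₁ t∈N  = u , ∨-inj₁ (S′ u) (fromWitness refl) , Adj-sym (proj₁ (∩N-elim {R} t∈N))
    ... | inj₂ t∈C′ with C′-dominated t t∈C′
    ...   | s , s∈S′ , ts = s , ∨-inj₂ ⌊ s ≟ u ⌋ s∈S′ , ts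

    -- C′ lies in R ∖ N(u), so the union defining C is disjoint.
    count-C : count C ≡ a + count C′
    count-C = count-∪-disjoint disjoint
      where
      disjoint : Disjoint (R ∩N u) C′
      disjoint t t∈N t∈C′ = proj₂ (∖N-elim {R} (C′⊆R′ t t∈C′)) (proj₁ (∩N-elim {R} t∈N))

    edges-bound : edges R W ≤ count C * (2 * Δ)
    edges-bound = begin
        edges R W
      ≤⟨ edges-around R W u ⟩
        edges (R ∩N u) (λ _ → true) + edges (R ∖N u) (W ∖N[ u ]) + edges R (W ∩N u)
      ≤⟨ +-mono-≤ (+-mono-≤ (edges-from-nbhd R u) edges′-bound) (edges-into-nbhd R W u u-max) ⟩
        a * Δ + count C′ * (2 * Δ) + Δ * a
      ≡⟨ regroup a (count C′) Δ ⟩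
        (a + count C′) * (2 * Δ)
      ≡⟨ cong (_* (2 * Δ)) count-C ⟨
        count C * (2 * Δ)
      ∎
      where
      open ≤-Reasoning
      regroup : ∀ a c Δ → a * Δ + c * (2 * Δ) + Δ * a ≡ (a + c) * (2 * Δ)
      regroup = solve-∀

    result : Greedy R W
    result = record { S = S ; C = C ; S-independent = S-independent ; S⊆W = S⊆W
                    ; C⊆R = C⊆R ; C-dominated = C-dominated ; edges-bound = edges-bound }

  greedy : ∀ k R W → count W < k → Greedy R W
  greedy (suc k) R W W<1+k with empty-or-max W (nbrs R)
  ... | inj₁ W-empty           = greedy-empty R W W-empty
  ... | inj₂ (u , u∈W , u-max) = GreedyStep.result R W u u∈W u-max
          (greedy k (R ∖N u) (W ∖N[ u ]) (<-≤-trans (∖N[]-shrinks W u u∈W) (≤-pred W<1+k)))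

  hasNbrIn : (Fin n → Bool) → Fin n → Bool
  hasNbrIn S v = ⌊ any? (λ s → T? (S s ∧ adj G v s)) ⌋

  hasNbrIn-intro : ∀ S {v} s → T (S s) → Adj G v s → T (hasNbrIn S v)
  hasNbrIn-intro S s s∈S vs = fromWitness (s , ∧-intro s∈S vs)

  hasNbrIn-elim : ∀ S {v} → T (hasNbrIn S v) → HasNbrIn S v
  hasNbrIn-elim S p with toWitness p
  ... | s , s∈S∧vs = s , ∧-elim s∈S∧vs

  extend : (Fin n → Bool) → (Fin n → Bool) → Fin n → Bool
  extend S R v = S v ∨ (R v ∧ not (hasNbrIn S v))

  -- The extension of an independent S by an independent R is independent:
  -- the added vertices of R have no neighbour in S.
  extend-independent : ∀ S R → IndependentB S → IndependentB R → IndependentB (extend S R)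
  extend-independent S R S-indep R-indep x y x∈T y∈T with ∨-elim x∈T | ∨-elim y∈T
  ... | inj₁ x∈S | inj₁ y∈S = S-indep x y x∈S y∈S
  ... | inj₁ x∈S | inj₂ y∈R∖NS =
        λ xy → not-elim (proj₂ (∧-elim y∈R∖NS)) (hasNbrIn-intro S x x∈S (Adj-sym xy))
  ... | inj₂ x∈R∖NS | inj₁ y∈S =
        λ xy → not-elim (proj₂ (∧-elim x∈R∖NS)) (hasNbrIn-intro S y y∈S xy)
  ... | inj₂ x∈R∖NS | inj₂ y∈R∖NS = R-indep x y (proj₁ (∧-elim x∈R∖NS)) (proj₁ (∧-elim y∈R∖NS))

  extend-dominates : ∀ S R v → T (R v) →
                     T (extend S R v) ⊎ ∃[ s ] (T (extend S R s) × Adj G v s)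
  extend-dominates S R v v∈R with T? (hasNbrIn S v)
  ... | yes v∈NS = let (s , s∈S , vs) = hasNbrIn-elim S v∈NS
                   in inj₂ (s , ∨-inj₁ (R s ∧ not (hasNbrIn S s)) s∈S , vs)
  ... | no  v∉NS = inj₁ (∨-inj₂ (S v) (∧-intro v∈R (not-intro v∉NS)))

  extend-overlap : ∀ S R C → Disjoint S R → C ⊆ᵇ R → (∀ t → T (C t) → HasNbrIn S t) →
                   count (λ v → R v ∧ extend S R v) + count C ≤ count R
  extend-overlap S R C S∩R=∅ C⊆R C-dominated = begin
    count (λ v → R v ∧ extend S R v) + count C    ≡⟨ count-∪-disjoint kept∩C=∅ ⟨
    count (λ v → (R v ∧ extend S R v) ∨ C v)      ≤⟨ count-mono {n} kept∪C⊆R ⟩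
    count R                                       ∎
    where
    open ≤-Reasoning
    kept-undominated : ∀ v → T (R v ∧ extend S R v) → ¬ T (hasNbrIn S v)
    kept-undominated v p with ∧-elim p
    ... | v∈R , v∈T with ∨-elim v∈T
    ...   | inj₁ v∈S     = ⊥-elim (S∩R=∅ v v∈S v∈R)
    ...   | inj₂ v∈R∖NS  = not-elim (proj₂ (∧-elim v∈R∖NS))
    kept∩C=∅ : Disjoint (λ v → R v ∧ extend S R v) C
    kept∩C=∅ v p v∈C = let (s , s∈S , vs) = C-dominated v v∈C
                       in kept-undominated v p (hasNbrIn-intro S s s∈S vs)
    kept∪C⊆R : (λ v → (R v ∧ extend S R v) ∨ C v) ⊆ᵇ R
    kept∪C⊆R v p with ∨-elim p
    ... | inj₁ kept = proj₁ (∧-elim kept)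
    ... | inj₂ v∈C  = C⊆R v v∈C

∈⇒T : ∀ {n} {p : Subset n} {v} → v ∈ p → T (Vec.lookup p v)
∈⇒T v∈p = subst T (sym ([]=⇒lookup v∈p)) tt

T⇒∈ : ∀ {n} (p : Subset n) v → T (Vec.lookup p v) → v ∈ p
T⇒∈ p v p[v] = lookup⇒[]= v p (Equivalence.to T-≡ p[v])

∈-tabulate⇒T : ∀ {n} (f : Fin n → Bool) {v} → v ∈ Vec.tabulate f → T (f v)
∈-tabulate⇒T f {v} v∈ = subst T (lookup∘tabulate f v) (∈⇒T v∈)

T⇒∈-tabulate : ∀ {n} (f : Fin n → Bool) v → T (f v) → v ∈ Vec.tabulate f
T⇒∈-tabulate f v fv = T⇒∈ (Vec.tabulate f) v (subst T (sym (lookup∘tabulate f v)) fv)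

∣∣≡count : ∀ {n} (p : Subset n) → ∣ p ∣ ≡ count (Vec.lookup p)
∣∣≡count Vec.[]          = refl
∣∣≡count (true  Vec.∷ p) = cong suc (∣∣≡count p)
∣∣≡count (false Vec.∷ p) = ∣∣≡count p

∣∩tabulate∣≡count : ∀ {n} (p : Subset n) (f : Fin n → Bool) →
                    ∣ p ∩ Vec.tabulate f ∣ ≡ count (λ v → Vec.lookup p v ∧ f v)
∣∩tabulate∣≡count p f = trans (∣∣≡count (p ∩ Vec.tabulate f)) (sum-cong-≗ λ v → cong ι (begin
  Vec.lookup (p ∩ Vec.tabulate f) v              ≡⟨ lookup-zipWith _∧_ v p (Vec.tabulate f) ⟩
  Vec.lookup p v ∧ Vec.lookup (Vec.tabulate f) v ≡⟨ cong (Vec.lookup p v ∧_) (lookup∘tabulate f v) ⟩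
  Vec.lookup p v ∧ f v                           ∎))
  where open ≡-Reasoning

ratio-bound : ∀ {x c r δ m} → x + c ≤ r → r * δ ≤ c * m → x * m ≤ (m ∸ δ) * r
ratio-bound {x} {c} {r} {δ} {m} x+c≤r rδ≤cm = begin
  x * m             ≤⟨ *-monoˡ-≤ m (m+n≤o⇒m≤o∸n x x+c≤r) ⟩
  (r ∸ c) * m       ≡⟨ *-distribʳ-∸ m r c ⟩
  r * m ∸ c * m     ≤⟨ ∸-monoʳ-≤ (r * m) rδ≤cm ⟩
  r * m ∸ r * δ     ≡⟨ *-distribˡ-∸ r m δ ⟨
  r * (m ∸ δ)       ≡⟨ *-comm r (m ∸ δ) ⟩
  (m ∸ δ) * r       ∎
  where open ≤-Reasoning

lemma4 : ∀ {n} (G : Graph n) → ¬ Edgeless G → (T₁ : Subset n) → Independent G T₁ →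
           ∃[ T₂ ] (IndepDominatingFor G T₂ T₁ ×
             ∣ T₁ ∩ T₂ ∣ * (2 * maxDegree G) ≤ (2 * maxDegree G ∸ minDegree G) * ∣ T₁ ∣)
lemma4 {n} G _ T₁ T₁-independent =
  T₂ , (T₂-independent , T₂-dominates) , ratio-bound {c = count C} parts-of-T₁ edge-count
  where
  R : Fin n → Bool
  R = Vec.lookup T₁
  R-independent : IndependentB G R
  R-independent u v u∈R v∈R = T₁-independent u v (T⇒∈ T₁ u u∈R) (T⇒∈ T₁ v v∈R)
  open Greedy (greedy G (suc (count (not ∘ R))) R (not ∘ R) ≤-refl)
  T₂ : Subset n
  T₂ = Vec.tabulate (extend G S R)
  T₂-independent : Independent G T₂
  T₂-independent u v u∈T₂ v∈T₂ = extend-independent G S R S-independent R-independent u v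
    (∈-tabulate⇒T (extend G S R) u∈T₂) (∈-tabulate⇒T (extend G S R) v∈T₂)
  T₂-dominates : Dominates G T₂ T₁
  T₂-dominates v v∈T₁ with extend-dominates G S R v (∈⇒T v∈T₁)
  ... | inj₁ v∈ext            = inj₁ (T⇒∈-tabulate (extend G S R) v v∈ext)
  ... | inj₂ (s , s∈ext , vs) = inj₂ (s , T⇒∈-tabulate (extend G S R) s s∈ext , vs)
  parts-of-T₁ : ∣ T₁ ∩ T₂ ∣ + count C ≤ ∣ T₁ ∣
  parts-of-T₁ = subst₂ (λ x r → x + count C ≤ r)
    (sym (∣∩tabulate∣≡count T₁ (extend G S R))) (sym (∣∣≡count T₁))
    (extend-overlap G S R C (λ v v∈S → not-elim (S⊆W v v∈S)) C⊆R C-dominated)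
  edge-count : ∣ T₁ ∣ * minDegree G ≤ count C * (2 * maxDegree G)
  edge-count = subst (λ r → r * minDegree G ≤ count C * (2 * maxDegree G)) (sym (∣∣≡count T₁))
    (≤-trans (independent-edges G R R-independent) edges-bound)
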